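{- Let $G$ be a connected graph. For every two finite-order oriented separations $(X,\mathcal C)\le(Y,\mathcal D)$ of $G$ (with $X,Y$ finite, $\mathcal C\subseteq\mathcal C_X$, $\mathcal D\subseteq\mathcal C_Y$) we have $\mathcal O_{|G|_\Theta}(X,\mathcal C)\supseteq\mathcal O_{|G|_\Theta}(Y,\mathcal D)$.
   Context: $G=(V,E)$. $\mathcal C_X$ is the set of components of $G-X$; $(X,\mathcal C):=(V\setminus V[\mathcal C],X\cup V[\mathcal C])$, $V[\mathcal C]$ the union of vertex sets of the members of $\mathcal C$; $(A,B)\le(C,D)$ iff $A\subseteq C$ and $B\supseteq D$. An $\aleph_0$-tangle of $G$ is a consistent orientation (exactly one of $(A,B),(B,A)$ chosen for each finite-order separation, with no distinct $r,s$ having orientations $\vec r<\vec s$ such that the inverse $\overleftarrow r$ and $\vec s$ both are chosen) of the set of finite-order separations of $G$ containing no finite star (set $\sigma$ of oriented separations with $\vec r\le\overleftarrow s$ for all distinct members) with finite interior $\bigcap\{B:(A,B)\in\sigma\}$; $\Theta$ is the set of $\aleph_0$-tangles. Viewing $G$ as a 1-complex, $|G|_\Theta$ has point set $G\sqcup\Theta$, and for finite $X\subseteq V$ and $\mathcal C\subseteq\mathcal C_X$, $\mathcal O_{|G|_\Theta}(X,\mathcal C):=\bigcup\mathcal C\cup\mathring E(X,\bigcup\mathcal C)\cup\{\tau\in\Theta:(X,\mathcal C)\in\tau\}$, where $\bigcup\mathcal C$ denotes the union of the components in $\mathcal C$ as subspaces of the 1-complex and $\mathring E(X,\bigcup\mathcal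 C)$ is the set of inner points of edges between $X$ and $\bigcup\mathcal C$. -}

module Defs where

open import Data.Product using (Σ; _×_; _,_; proj₁; proj₂)
open import Data.Sum using (_⊎_)
open import Data.Empty using (⊥)
open import Data.List using (List; []; _∷_)
open import Data.Unit using (⊤)
open import Data.List.Membership.Propositional using (_∈_)
open import Data.List.Relation.Unary.All using (All)
open import Relation.Nullary using (¬_)

record Graph : Set₁ where
  field
    V       : Set
    _~_     : V → V → Set
    ~-sym   : ∀ {u v} → u ~ v → v ~ u
    ~-irrefl : ∀ {v} → ¬ (v ~ v)

module _ (G : Graph) where
  open Graph G

  VSet : Set₁
  VSet = V → Set

  _⊆_ : VSet → VSet → Set
  A ⊆ B = ∀ v → A v → B v

  _≐_ : VSet → VSet → Set
  A ≐ B = A ⊆ B × B ⊆ A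

  Finite : VSet → Set
  Finite S = Σ (List V) λ xs → ∀ v → (S v → v ∈ xs) × (v ∈ xs → S v)

  data WalkIn (S : VSet) : V → V → Set where
    here : ∀ {v} → S v → WalkIn S v v
    step : ∀ {u w v} → S u → u ~ w → WalkIn S w v → WalkIn S u v

  ConnectedSet : VSet → Set
  ConnectedSet S = ∀ u v → S u → S v → WalkIn S u v

  Connected : Set
  Connected = V × (∀ u v → WalkIn (λ _ → ⊤) u v)

  Avoids : VSet → VSet → Set
  Avoids X K = ∀ v → K v → ¬ X v

  IsComponent : VSet → VSet → Set₁
  IsComponent X K =
    Σ V K × Avoids X K × ConnectedSet K ×
    (∀ (K' : VSet) → Avoids X K' → ConnectedSet K' → K ⊆ K' → K' ⊆ K)

  Sep : Set₁
  Sep = VSet × VSet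

  _* : Sep → Sep
  (A , B) * = (B , A)

  _≤ˢ_ : Sep → Sep → Set
  (A , B) ≤ˢ (C , D) = A ⊆ C × D ⊆ B

  _≐ˢ_ : Sep → Sep → Set
  (A , B) ≐ˢ (C , D) = A ≐ C × B ≐ D

  IsSep : Sep → Set
  IsSep (A , B) =
    (∀ v → A v ⊎ B v) ×
    (∀ u v → A u → ¬ B u → B v → ¬ A v → ¬ (u ~ v))

  FOSep : Sep → Set
  FOSep (A , B) = IsSep (A , B) × Finite (λ v → A v × B v)

  IsStar : List Sep → Set₁
  IsStar σ = ∀ r s → r ∈ σ → s ∈ σ → ¬ (r ≐ˢ s) → r ≤ˢ (s *)

  Interior : List Sep → VSet
  Interior [] v = ⊤
  Interior (s ∷ σ) v = proj₂ s v × Interior σ v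

  -- ℵ₀-tangles: consistent orientations of the finite-order separations
  -- containing no finite star with finite interior
  record IsTangle (τ : Sep → Set) : Set₁ where
    field
      only-FO    : ∀ s → τ s → FOSep s
      respects   : ∀ s s' → s ≐ˢ s' → τ s → τ s'
      orients    : ∀ s → FOSep s → τ s ⊎ τ (s *)
      exactlyOne : ∀ s → τ s → τ (s *) → s ≐ˢ (s *)
      consistent : ∀ r s → FOSep r → FOSep s →
                   ¬ (r ≐ˢ s) → ¬ (r ≐ˢ (s *)) →
                   r ≤ˢ s → τ (r *) → τ s → ⊥
      noFinStar  : ∀ (σ : List Sep) → IsStar σ → All τ σ →
                   ¬ Finite (Interior σ)

  Tangle : Set₁
  Tangle = Σ (Sep → Set) IsTangle

  -- V[𝒞] for a set 𝒞 of components given as an indexed family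
  Vof : {ι : Set} → (ι → VSet) → VSet
  Vof {ι} K v = Σ ι λ i → K i v

  -- (X, 𝒞) := (V ∖ V[𝒞], X ∪ V[𝒞])
  sepOf : VSet → {ι : Set} → (ι → VSet) → Sep
  sepOf X K = (λ v → ¬ Vof K v) , (λ v → X v ⊎ Vof K v)

  -- points of |G|_Θ: vertices, inner points of edges (the edge uv with
  -- inner coordinate t ∈ I, where I stands for the open interval (0,1)),
  -- and ℵ₀-tangles
  data Point (I : Set) : Set₁ where
    vtx   : V → Point I
    inner : (u v : V) → u ~ v → I → Point I
    end   : Tangle → Point I

  𝒪 : (I : Set) → VSet → {ι : Set} → (ι → VSet) → Point I → Set
  𝒪 I X K (vtx v) = Vof K v
  𝒪 I X K (inner u v _ _) =
    (Σ _ λ i → K i u × K i v) ⊎ (X u × Vof K v) ⊎ (X v × Vof K u)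
  𝒪 I X K (end (τ , _)) = τ (sepOf X K)

module Submission where

-- The inclusion 𝒪(Y,𝒟) ⊆ 𝒪(X,𝒞) is checked separately on the three
-- kinds of points of |G|_Θ:
--  * vertices: (X,𝒞) ≤ (Y,𝒟) says V ∖ V[𝒞] ⊆ V ∖ V[𝒟], i.e.
--    (classically) V[𝒟] ⊆ V[𝒞];
--  * inner edge points: every component of G − X absorbs all its
--    neighbours outside X, so an edge leaving V[𝒟] or Y either stays
--    inside one component of 𝒞 or has its other end in X;
--  * ℵ₀-tangles: (X,𝒞) is a separation of finite order, and every
--    tangle is down-closed on finite-order separations (the only
--    delicate case, (X,𝒞) = (Y,𝒟)*, yields a one-element star with
--    finite interior).

open import Defs
open import Level using (0ℓ)
open import Axiom.ExcludedMiddle using (ExcludedMiddle)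
open import Axiom.DoubleNegationElimination using (em⇒dne)
open import Data.List using (List; []; _∷_; filter)
open import Data.List.Membership.Propositional using (_∈_)
open import Data.List.Membership.Propositional.Properties using (∈-filter⁺; ∈-filter⁻)
open import Data.List.Relation.Unary.Any using (here; there)
open import Data.List.Relation.Unary.All using ([]; _∷_)
open import Data.Product using (Σ; _×_; _,_; proj₁; proj₂; swap)
open import Data.Sum using (_⊎_; inj₁; inj₂; map; map₂)
open import Data.Empty using (⊥-elim)
open import Data.Unit using (tt)
open import Relation.Nullary using (¬_; yes; no)
open import Relation.Binary.PropositionalEquality using (_≡_; refl)

module GraphFacts (G : Graph) where
  open Graph G

  walk-mono : ∀ {S S' : VSet G} {a b} → _⊆_ G S S' → WalkIn G S a b → WalkIn G S' a b
  walk-mono S⊆S' (here s)     = here (S⊆S' _ s)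
  walk-mono S⊆S' (step s e w) = step (S⊆S' _ s) e (walk-mono S⊆S' w)

  walk-join : ∀ {S : VSet G} {a b c d} → WalkIn G S a b → b ~ c → WalkIn G S c d → WalkIn G S a d
  walk-join (here s)      e w = step s e w
  walk-join (step s e' w) e w' = step s e' (walk-join w e w')

  -- A component of G − X contains every neighbour of its vertices that is
  -- not in X: adding such a neighbour keeps the set connected and
  -- disjoint from X, so maximality applies.
  component-absorbs : ∀ {X K : VSet G} → IsComponent G X K →
    ∀ {u v} → K v → u ~ v → ¬ X u → K u
  component-absorbs {X} {K} (_ , avoids , connected , maximal) {u} {v} kv e u∉X =
    maximal K+u avoids' connected' (λ _ → inj₁) u (inj₂ refl)
    where
    K+u : VSet G
    K+u w = K w ⊎ w ≡ u
    avoids' : Avoids G X K+u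
    avoids' w (inj₁ kw)  = avoids w kw
    avoids' w (inj₂ refl) = u∉X
    inK : ∀ {a b} → K a → K b → WalkIn G K+u a b
    inK ka kb = walk-mono (λ _ → inj₁) (connected _ _ ka kb)
    connected' : ConnectedSet G K+u
    connected' a b (inj₁ ka)  (inj₁ kb)  = inK ka kb
    connected' a b (inj₁ ka)  (inj₂ refl) = walk-join (inK ka kv) (~-sym e) (here (inj₂ refl))
    connected' a b (inj₂ refl) (inj₁ kb)  = step (inj₂ refl) e (inK kv kb)
    connected' a b (inj₂ refl) (inj₂ refl) = here (inj₂ refl)

  components-meet : ∀ {X K K' : VSet G} → IsComponent G X K → IsComponent G X K' →
    ∀ {u v} → K u → K' v → u ~ v → K v
  components-meet compK (_ , avoids' , _) ku k'v e =
    component-absorbs compK ku (~-sym e) (avoids' _ k'v)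

  complement-⊆ : ExcludedMiddle 0ℓ → {P Q : VSet G} →
    _⊆_ G (λ v → ¬ P v) (λ v → ¬ Q v) → _⊆_ G Q P
  complement-⊆ em ¬P⊆¬Q v q = em⇒dne em (λ ¬p → ¬P⊆¬Q v ¬p q)

  finite-resp-≐ : ∀ {S T : VSet G} → _≐_ G S T → Finite G S → Finite G T
  finite-resp-≐ (S⊆T , T⊆S) (xs , enum) =
    xs , λ v → (λ t → proj₁ (enum v) (T⊆S v t)) , (λ m → S⊆T v (proj₂ (enum v) m))

  finite-within : ExcludedMiddle 0ℓ → (xs : List V) (P : VSet G) →
    Finite G (λ v → v ∈ xs × P v)
  finite-within em xs P =
    filter P? xs , λ v → (λ (m , p) → ∈-filter⁺ P? m p) , ∈-filter⁻ P? {xs = xs}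
    where
    P? = λ v → em {P v}

  module Separation {X : VSet G} {ι : Set} (K : ι → VSet G)
                    (compK : ∀ i → IsComponent G X (K i)) where

    -- (X,𝒞) is a separation: the sides cover V, and no edge joins
    -- V ∖ V[𝒞] ∖ X to V[𝒞], since components absorb their neighbours.
    sepOf-isSep : ExcludedMiddle 0ℓ → IsSep G (sepOf G X K)
    sepOf-isSep em = cover , no-edge
      where
      cover : ∀ v → ¬ Vof G K v ⊎ (X v ⊎ Vof G K v)
      cover v with em {Vof G K v}
      ... | yes k = inj₂ (inj₂ k)
      ... | no ¬k = inj₁ ¬k
      no-edge : ∀ u v → ¬ Vof G K u → ¬ (X u ⊎ Vof G K u) →
                (X v ⊎ Vof G K v) → ¬ ¬ Vof G K v → ¬ (u ~ v)
      no-edge u v _ u∉B _ ¬¬kv e with em⇒dne em ¬¬kv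
      ... | i , kv = u∉B (inj₂ (i , component-absorbs (compK i) kv e (λ x → u∉B (inj₁ x))))

    sepOf-separator : _≐_ G (λ v → ¬ Vof G K v × (X v ⊎ Vof G K v))
                            (λ v → X v × ¬ Vof G K v)
    sepOf-separator = to , (λ v (x , ¬k) → ¬k , inj₁ x)
      where
      to : _⊆_ G (λ v → ¬ Vof G K v × (X v ⊎ Vof G K v)) (λ v → X v × ¬ Vof G K v)
      to v (¬k , inj₁ x) = x , ¬k
      to v (¬k , inj₂ k) = ⊥-elim (¬k k)

    edge-into-components : ∀ {u v} → (X u ⊎ Vof G K u) → Vof G K v → u ~ v →
      (Σ ι λ i → K i u × K i v) ⊎ (X u × Vof G K v)
    edge-into-components (inj₁ xu)        kv       e = inj₂ (xu , kv)
    edge-into-components (inj₂ (i , ku)) (i' , kv) e =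
      inj₁ (i , ku , components-meet (compK i) (compK i') ku kv e)

    𝒪-inner-mono : ∀ {Y : VSet G} {κ : Set} {L : κ → VSet G} {I : Set} →
      _⊆_ G (Vof G L) (Vof G K) → _⊆_ G Y (λ v → X v ⊎ Vof G K v) →
      ∀ {u v} (e : u ~ v) (t : I) → 𝒪 G I Y L (inner u v e t) → 𝒪 G I X K (inner u v e t)
    𝒪-inner-mono L⊆K Y⊆B e t (inj₁ (j , lu , lv)) =
      map₂ inj₁ (edge-into-components (inj₂ (L⊆K _ (j , lu))) (L⊆K _ (j , lv)) e)
    𝒪-inner-mono L⊆K Y⊆B e t (inj₂ (inj₁ (yu , lv))) =
      map₂ inj₁ (edge-into-components (Y⊆B _ yu) (L⊆K _ lv) e)
    𝒪-inner-mono L⊆K Y⊆B e t (inj₂ (inj₂ (yv , lu))) =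
      map (λ (i , kv , ku) → i , ku , kv) inj₂
          (edge-into-components (Y⊆B _ yv) (L⊆K _ lu) (~-sym e))

  sepOf-FOSep : ExcludedMiddle 0ℓ → (xs : List V) {ι : Set} (K : ι → VSet G) →
    (∀ i → IsComponent G (λ v → v ∈ xs) (K i)) → FOSep G (sepOf G (λ v → v ∈ xs) K)
  sepOf-FOSep em xs K compK =
    sepOf-isSep em ,
    finite-resp-≐ (swap sepOf-separator) (finite-within em xs (λ v → ¬ Vof G K v))
    where open Separation K compK

  ≐ˢ-refl : ∀ {s : Sep G} → _≐ˢ_ G s s
  ≐ˢ-refl = ((λ _ x → x) , (λ _ x → x)) , ((λ _ x → x) , (λ _ x → x))

  ≐ˢ-sym : ∀ {r s : Sep G} → _≐ˢ_ G r s → _≐ˢ_ G s r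
  ≐ˢ-sym ((A⊆C , C⊆A) , (B⊆D , D⊆B)) = (C⊆A , A⊆C) , (D⊆B , B⊆D)

  singleton-star : (s : Sep G) → IsStar G (s ∷ [])
  singleton-star s _ _ (here refl) (here refl) s≠s = ⊥-elim (s≠s ≐ˢ-refl)
  singleton-star s _ _ (here refl) (there ())  _
  singleton-star s _ _ (there ())  _           _

  -- If τ chose r*
  -- instead of r ≤ s, consistency forces r ≐ s or r ≐ s*; in the latter
  -- case D ⊆ A ⊆ C for s = (C,D), so the interior D of the star {s} is
  -- contained in the finite separator of s.
  tangle-down-closed : ExcludedMiddle 0ℓ → ∀ {τ} → IsTangle G τ →
    ∀ {r s} → FOSep G r → _≤ˢ_ G r s → τ s → τ r
  tangle-down-closed em {τ} T {r} {s} r-FO r≤s τs with IsTangle.orients T r r-FO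
  ... | inj₁ τr = τr
  ... | inj₂ τr* with em {_≐ˢ_ G r s} | em {_≐ˢ_ G r (_* G s)}
  ...   | yes r≐s | _ = IsTangle.respects T s r (≐ˢ-sym r≐s) τs
  ...   | no r≠s | no r≠s* =
    ⊥-elim (IsTangle.consistent T r s r-FO (IsTangle.only-FO T s τs) r≠s r≠s* r≤s τr* τs)
  ...   | no _ | yes ((A⊆D , D⊆A) , _) =
    ⊥-elim (IsTangle.noFinStar T (s ∷ []) (singleton-star s) (τs ∷ [])
              (finite-resp-≐ interior≐separator (proj₂ (IsTangle.only-FO T s τs))))
    where
    interior≐separator : _≐_ G (λ v → proj₁ s v × proj₂ s v) (Interior G (s ∷ []))
    interior≐separator = (λ v (_ , d) → d , tt) ,
                         (λ v (d , _) → proj₁ r≤s v (D⊆A v d) , d)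

lemma6p3 : ExcludedMiddle 0ℓ →
    (G : Graph) → Connected G → (I : Set) →
    (xs ys : List (Graph.V G)) →
    {ι κ : Set} (K : ι → VSet G) (L : κ → VSet G) →
    (∀ i → IsComponent G (λ v → v ∈ xs) (K i)) →
    (∀ j → IsComponent G (λ v → v ∈ ys) (L j)) →
    _≤ˢ_ G (sepOf G (λ v → v ∈ xs) K) (sepOf G (λ v → v ∈ ys) L) →
    ∀ (p : Point G I) → 𝒪 G I (λ v → v ∈ ys) L p → 𝒪 G I (λ v → v ∈ xs) K p
lemma6p3 em G _ I xs ys K L compK _ r≤s = monotone
  where
  open GraphFacts G
  open Separation K compK

  L⊆K : _⊆_ G (Vof G L) (Vof G K)
  L⊆K = complement-⊆ em (proj₁ r≤s)

  Y⊆B : _⊆_ G (λ v → v ∈ ys) (λ v → v ∈ xs ⊎ Vof G K v)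
  Y⊆B v y = proj₂ r≤s v (inj₁ y)

  monotone : ∀ p → 𝒪 G I (λ v → v ∈ ys) L p → 𝒪 G I (λ v → v ∈ xs) K p
  monotone (vtx v)         = L⊆K v
  monotone (inner u v e t) = 𝒪-inner-mono L⊆K Y⊆B e t
  monotone (end (τ , T))   = tangle-down-closed em T (sepOf-FOSep em xs K compK) r≤s
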